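{- Let $\Sigma$ be an alphabet and $w\in\Sigma^*$. Then $s(w)$ is repetition-free (no letter occurs twice); $w$ and $s(w)$ have the same first letter and the same last letter; a letter occurs in $s(w)$ only if it occurs in $w$; and a two-letter word $xy$ occurs as a factor of $s(w)$ only if it occurs as a factor of $w$.
   Context: The word simplification function $s:\Sigma^*\to\Sigma^*$ is defined inductively by $s(\lambda):=\lambda$ ($\lambda$ the empty word) and, for $w\in\Sigma^*$ and $a\in\Sigma$: if $a$ does not occur in $s(w)$ then $s(wa):=s(w)a$; if $a$ occurs in $s(w)$ then $s(wa)$ is the shortest prefix of $s(w)$ that ends with $a$. -}

module Defs where

open import Data.Bool using (Bool; true; false)
open import Data.List using (List; []; _∷_; _++_; [_]; foldl)
open import Data.Maybe using (Maybe; just; nothing)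
open import Data.Product using (∃; ∃-syntax)
open import Relation.Binary.Definitions using (DecidableEquality)
open import Relation.Binary.PropositionalEquality using (_≡_)
open import Relation.Nullary using (yes; no)

module _ {A : Set} (_≟_ : DecidableEquality A) where

  occursB : A → List A → Bool
  occursB a [] = false
  occursB a (b ∷ u) with a ≟ b
  ... | yes _ = true
  ... | no _  = occursB a u

  -- shortest prefix of u ending with a (used only when a occurs in u)
  prefixTo : A → List A → List A
  prefixTo a [] = []
  prefixTo a (b ∷ u) with a ≟ b
  ... | yes _ = b ∷ []
  ... | no _  = b ∷ prefixTo a u

  step : List A → A → List A
  step sw a with occursB a sw
  ... | true  = prefixTo a sw
  ... | false = sw ++ [ a ]

  -- the word simplification function s: s(λ) = λ, s(wa) = step (s w) a
  simp : List A → List A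
  simp = foldl step []

lastL : {A : Set} → List A → Maybe A
lastL [] = nothing
lastL (a ∷ []) = just a
lastL (a ∷ b ∷ u) = lastL (b ∷ u)

Factor2 : {A : Set} → A → A → List A → Set
Factor2 x y w = ∃[ u ] ∃[ v ] (w ≡ u ++ x ∷ y ∷ v)

module Submission where

-- Call s a *faithful simplification* of w when s is
-- repetition-free, has the same first and last letter as w, and every letter
-- and every two-letter factor of s also occurs in w.  Since simp = foldl step [],
-- the theorem says that simp w is a faithful simplification of w, and it
-- suffices to show that faithfulness is preserved by one step:
-- if s is faithful for w, then step s a is faithful for w ++ [ a ].
--
-- One step is controlled by three facts about step s a:
--   * it is a prefix of s ++ [ a ]  (either s ++ [ a ] itself or a prefix of s);
--   * it ends with a;
--   * it is repetition-free whenever s is.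
-- Being a prefix of s ++ [ a ] transports first letter, letters and factors
-- from step s a to s ++ [ a ], and from there to w ++ [ a ] by the hypothesis
-- on s; the only new factor of s ++ [ a ] is (last letter of s) a, which is
-- also a factor of w ++ [ a ] because s and w end with the same letter.

open import Defs
open import Data.List using (List; head; []; _∷_; _++_; [_]; foldl)
open import Data.List.Properties using (∷-injective; ++-assoc; ++-identityʳ)
open import Data.List.Membership.Propositional using (_∈_; _∉_)
open import Data.List.Relation.Binary.Subset.Propositional.Properties
  using (xs⊆xs++ys; ++⁺ˡ)
open import Data.List.Relation.Unary.All using ([])
open import Data.List.Relation.Unary.All.Properties as All using ()
open import Data.List.Relation.Unary.AllPairs using ([]; _∷_)
open import Data.List.Relation.Unary.Any using (here; there)
open import Data.List.Relation.Unary.Unique.Propositional using (Unique)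
open import Data.List.Relation.Unary.Unique.Propositional.Properties as Unique using ()
open import Data.Bool using (true; false)
open import Data.Maybe using (just)
open import Data.Empty using (⊥)
open import Data.Product using (_×_; _,_; ∃-syntax)
open import Data.Sum using (_⊎_; inj₁; inj₂)
open import Relation.Nullary using (yes; no)
open import Relation.Binary.Definitions using (DecidableEquality)
open import Relation.Binary.PropositionalEquality
  using (_≡_; _≢_; refl; sym; trans; cong; subst; module ≡-Reasoning)

module _ {A : Set} where

  Faithful : List A → List A → Set
  Faithful w s = Unique s × head s ≡ head w × lastL s ≡ lastL w
               × (∀ a → a ∈ s → a ∈ w) × (∀ x y → Factor2 x y s → Factor2 x y w)

  faithful-[] : Faithful [] []
  faithful-[] = [] , refl , refl , (λ _ ()) , λ { _ _ ([] , _ , ()) ; _ _ (_ ∷ _ , _ , ()) }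

  head-++-cong : ∀ {s w} (t : List A) → head s ≡ head w → head (s ++ t) ≡ head (w ++ t)
  head-++-cong {[]}    {[]}    t _ = refl
  head-++-cong {_ ∷ _} {_ ∷ _} t e = e

  head-++ : (p r : List A) → p ≢ [] → head (p ++ r) ≡ head p
  head-++ []      r p≢[] with () ← p≢[] refl
  head-++ (_ ∷ _) r _ = refl

  last⇒nonempty : ∀ {x} (p : List A) → lastL p ≡ just x → p ≢ []
  last⇒nonempty [] () refl

  last-snoc : (s : List A) (a : A) → lastL (s ++ [ a ]) ≡ just a
  last-snoc []          a = refl
  last-snoc (_ ∷ [])    a = refl
  last-snoc (_ ∷ c ∷ s) a = last-snoc (c ∷ s) a

  last-cons : ∀ {x} (b : A) (t : List A) → lastL t ≡ just x → lastL (b ∷ t) ≡ just x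
  last-cons b []      ()
  last-cons b (_ ∷ _) l = l

  last-split : ∀ {x} (w : List A) → lastL w ≡ just x → ∃[ u ] (w ≡ u ++ [ x ])
  last-split (_ ∷ [])    refl = [] , refl
  last-split (b ∷ c ∷ w) l with last-split (c ∷ w) l
  ... | u , e = b ∷ u , cong (b ∷_) e

  factor-++ : ∀ {x y} (p r : List A) → Factor2 x y p → Factor2 x y (p ++ r)
  factor-++ {x} {y} p r (u , v , refl) = u , v ++ r , ++-assoc u (x ∷ y ∷ v) r

  factor-snoc : ∀ {x y a} (s u v : List A) → s ++ [ a ] ≡ u ++ x ∷ y ∷ v →
                Factor2 x y s ⊎ (s ≡ u ++ [ x ] × y ≡ a)
  factor-snoc []          []            v ()
  factor-snoc (_ ∷ [])    []            v refl = inj₂ (refl , refl)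
  factor-snoc (_ ∷ _ ∷ s) []            v refl = inj₁ ([] , s , refl)
  factor-snoc []          (_ ∷ [])      v ()
  factor-snoc []          (_ ∷ _ ∷ _)   v ()
  factor-snoc (b ∷ s)     (c ∷ u)       v e with ∷-injective e
  ... | refl , e′ with factor-snoc s u v e′
  ...   | inj₁ (u′ , v′ , refl) = inj₁ (b ∷ u′ , v′ , refl)
  ...   | inj₂ (refl , y≡a)     = inj₂ (refl , y≡a)

  -- Factor inclusion s ⊆ w extends to s ++ [ a ] ⊆ w ++ [ a ] when s and w
  -- end with the same letter (the new factor crosses the junction).
  factor-snoc-mono : ∀ {s w : List A} (a : A) → lastL s ≡ lastL w →
    (∀ x y → Factor2 x y s → Factor2 x y w) →
    ∀ x y → Factor2 x y (s ++ [ a ]) → Factor2 x y (w ++ [ a ])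
  factor-snoc-mono {s} {w} a L F x y (u , v , e) with factor-snoc s u v e
  ... | inj₁ f = factor-++ w [ a ] (F x y f)
  ... | inj₂ (refl , refl) with last-split w (trans (sym L) (last-snoc u x))
  ...   | u′ , refl = u′ , [] , ++-assoc u′ [ x ] [ a ]

  unique-prefix : (p r : List A) → Unique (p ++ r) → Unique p
  unique-prefix []      r _         = []
  unique-prefix (_ ∷ p) r (x∉ ∷ u) = All.++⁻ˡ p x∉ ∷ unique-prefix p r u

  unique-snoc : ∀ {a} (s : List A) → Unique s → a ∉ s → Unique (s ++ [ a ])
  unique-snoc s u a∉s = Unique.++⁺ u ([] ∷ []) disjoint
    where
    disjoint : ∀ {v} → v ∈ s × v ∈ [ _ ] → ⊥
    disjoint (v∈s , here refl) = a∉s v∈s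

  module _ (_≟_ : DecidableEquality A) where

    occursB-false : ∀ a s → occursB _≟_ a s ≡ false → a ∉ s
    occursB-false a (b ∷ s) o a∈ with a ≟ b | a∈
    occursB-false a (b ∷ s) () _ | yes _ | _
    ... | no a≢b | here a≡b  = a≢b a≡b
    ... | no _   | there a∈s = occursB-false a s o a∈s

    prefixTo-prefix : ∀ a s → ∃[ r ] (s ≡ prefixTo _≟_ a s ++ r)
    prefixTo-prefix a []      = [] , refl
    prefixTo-prefix a (b ∷ s) with a ≟ b
    ... | yes _ = s , refl
    ... | no _ with prefixTo-prefix a s
    ...   | r , e = r , cong (b ∷_) e

    prefixTo-last : ∀ a s → occursB _≟_ a s ≡ true → lastL (prefixTo _≟_ a s) ≡ just a
    prefixTo-last a (b ∷ s) o with a ≟ b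
    ... | yes refl = refl
    ... | no _     = last-cons b (prefixTo _≟_ a s) (prefixTo-last a s o)

    step-prefix : ∀ s a → ∃[ r ] (s ++ [ a ] ≡ step _≟_ s a ++ r)
    step-prefix s a with occursB _≟_ a s
    ... | false = [] , sym (++-identityʳ (s ++ [ a ]))
    ... | true with prefixTo-prefix a s
    ...   | r , e = r ++ [ a ] , trans (cong (_++ [ a ]) e) (++-assoc (prefixTo _≟_ a s) r [ a ])

    step-last : ∀ s a → lastL (step _≟_ s a) ≡ just a
    step-last s a with occursB _≟_ a s in o
    ... | false = last-snoc s a
    ... | true  = prefixTo-last a s o

    step-unique : ∀ s a → Unique s → Unique (step _≟_ s a)
    step-unique s a u with occursB _≟_ a s in o
    ... | false = unique-snoc s u (occursB-false a s o)
    ... | true with prefixTo-prefix a s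
    ...   | r , e = unique-prefix (prefixTo _≟_ a s) r (subst Unique e u)

    step-faithful : ∀ w s a → Faithful w s → Faithful (w ++ [ a ]) (step _≟_ s a)
    step-faithful w s a (U , H , L , M , F) with step-prefix s a
    ... | r , e =
      step-unique s a U , first , last , letters , factors
      where
      t = step _≟_ s a
      open ≡-Reasoning
      first : head t ≡ head (w ++ [ a ])
      first = begin
        head t             ≡⟨ sym (head-++ t r (last⇒nonempty t (step-last s a))) ⟩
        head (t ++ r)      ≡⟨ cong head (sym e) ⟩
        head (s ++ [ a ])  ≡⟨ head-++-cong [ a ] H ⟩
        head (w ++ [ a ])  ∎
      last : lastL t ≡ lastL (w ++ [ a ])
      last = trans (step-last s a) (sym (last-snoc w a))
      letters : ∀ b → b ∈ t → b ∈ w ++ [ a ]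
      letters b b∈t = ++⁺ˡ [ a ] (λ {c} → M c) (subst (b ∈_) (sym e) (xs⊆xs++ys t r b∈t))
      factors : ∀ x y → Factor2 x y t → Factor2 x y (w ++ [ a ])
      factors x y f = factor-snoc-mono a L F x y (subst (Factor2 x y) (sym e) (factor-++ t r f))

    foldl-faithful : ∀ v w s → Faithful w s → Faithful (w ++ v) (foldl (step _≟_) s v)
    foldl-faithful []      w s φ = subst (λ w′ → Faithful w′ s) (sym (++-identityʳ w)) φ
    foldl-faithful (a ∷ v) w s φ =
      subst (λ w′ → Faithful w′ (foldl (step _≟_) (step _≟_ s a) v)) (++-assoc w [ a ] v)
        (foldl-faithful v (w ++ [ a ]) (step _≟_ s a) (step-faithful w s a φ))

lemma10 : {A : Set} (_≟_ : DecidableEquality A) (w : List A) →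
    Unique (simp _≟_ w)
    × head (simp _≟_ w) ≡ head w
    × lastL (simp _≟_ w) ≡ lastL w
    × (∀ a → a ∈ simp _≟_ w → a ∈ w)
    × (∀ x y → Factor2 x y (simp _≟_ w) → Factor2 x y w)
lemma10 _≟_ w = foldl-faithful _≟_ w [] [] faithful-[]
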